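{- Let $\ell_1,\ell_2\in\mathbb{N}$ and let $D$ be a digraph with $\delta^+(D)\ge\ell_1+\ell_2$. Then for every $v\in V(D)$ there are directed paths $P_1$ and $P_2$ in $D$ of lengths $\ell_1$ and $\ell_2$ respectively, both starting at $v$, with $V(P_1)\cap V(P_2)=\{v\}$.
   Context: Digraphs are finite, loopless, without parallel arcs, but may contain digons. $\delta^+(D)$ is the minimum out-degree; the length of a path is its number of arcs. -}

module Defs where

open import Data.Nat using (ℕ; zero; suc; _+_; _≤_)
open import Data.Bool using (Bool; true; false; T)
open import Data.Fin using (Fin; zero; suc)
open import Data.Vec using (Vec; []; _∷_; head; toList)
open import Data.List using (List; filter; length)
open import Data.List.Relation.Unary.Unique.Propositional using (Unique)
open import Data.List.Membership.Propositional using (_∈_)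
open import Data.List.Relation.Unary.All using (All)
open import Data.Unit using (⊤)
open import Data.List.Base using (allFin)
open import Data.Product using (_×_; Σ; _,_)
open import Relation.Binary.PropositionalEquality using (_≡_)
open import Relation.Nullary using (¬_)
open import Relation.Nullary.Decidable using (Dec)
open import Data.Bool.Properties using (T?)

-- A finite digraph on vertex set Fin n: an arc relation given by a
-- Boolean adjacency function, loopless. Digons (u→v and v→u) are allowed;
-- parallel arcs cannot occur since arcs are a relation.
record Digraph : Set where
  field
    n     : ℕ
    arc   : Fin n → Fin n → Bool
    loopless : ∀ v → arc v v ≡ false

open Digraph public

Vertex : Digraph → Set
Vertex D = Fin (n D)

Arc : (D : Digraph) → Vertex D → Vertex D → Set
Arc D u v = T (arc D u v)

outDeg : (D : Digraph) → Vertex D → ℕ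
outDeg D v = length (filter (λ w → T? (arc D v w)) (allFin (n D)))

minOutDeg≥ : Digraph → ℕ → Set
minOutDeg≥ D k = ∀ v → k ≤ outDeg D v

Walk : (D : Digraph) → ∀ {m} → Vec (Vertex D) m → Set
Walk D []           = ⊤
Walk D (_ ∷ [])     = ⊤
Walk D (u ∷ v ∷ vs) = Arc D u v × Walk D (v ∷ vs)

record Path (D : Digraph) (ℓ : ℕ) : Set where
  field
    verts    : Vec (Vertex D) (suc ℓ)
    walk     : Walk D verts
    distinct : Unique (toList verts)

open Path public

start : ∀ {D ℓ} → Path D ℓ → Vertex D
start P = head (verts P)

_∈V_ : ∀ {D ℓ} → Vertex D → Path D ℓ → Set
v ∈V P = v ∈ toList (verts P)

-- Grow the two paths one after the other, greedily.  A path of length ℓ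
-- starting at u and avoiding a forbidden set F exists whenever δ⁺(D) ≥ |F| + ℓ:
-- the out-neighbours of u are distinct, so one of them, w, lies outside F,
-- and a path of length ℓ - 1 from w avoiding F ∪ {u} can be prepended with u.
-- Take P₁ avoiding nothing, then P₂ avoiding the ℓ₁ vertices of P₁ other than v.
module Submission where

open import Defs
open import Data.Nat using (ℕ; zero; suc; _+_; _≤_; _<_; z<s; s≤s⁻¹)
open import Data.Nat.Properties using (≤-trans; ≤-reflexive; m≤m+n; +-suc; m<m+n)
open import Data.Product using (Σ; ∃-syntax; _×_; _,_; proj₂)
open import Data.Sum using (_⊎_; inj₁; inj₂)
open import Data.Fin using (_≟_)
open import Data.Vec using (Vec; []; _∷_; head; tail; toList)
open import Data.Vec.Properties using (length-toList)
open import Data.List using (List; []; _∷_; length; filter; allFin)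
open import Data.List.Properties using (length-removeAt′)
open import Data.List.Membership.Propositional using (_∈_; _∉_; _─_)
open import Data.List.Membership.Propositional.Properties using (∈-filter⁻)
open import Data.List.Relation.Unary.Any using (here; there; index)
open import Data.List.Relation.Unary.All as All using (All; []; _∷_)
open import Data.List.Relation.Unary.All.Properties using (¬Any⇒All¬; All¬⇒¬Any)
open import Data.List.Relation.Unary.AllPairs using ([]; _∷_)
open import Data.List.Relation.Unary.Unique.Propositional using (Unique)
open import Data.List.Relation.Unary.Unique.Propositional.Properties using (filter⁺; allFin⁺)
open import Data.Bool using (T)
open import Data.Bool.Properties using (T?)
open import Data.Unit using (tt)
open import Relation.Binary.Definitions using (DecidableEquality)
open import Relation.Binary.PropositionalEquality using (_≡_; _≢_; refl; sym; cong; subst)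
open import Relation.Nullary using (¬_; yes; no; contradiction)

∈-─⁺ : ∀ {A : Set} {x y : A} {xs : List A} (x∈xs : x ∈ xs) → y ∈ xs → y ≢ x → y ∈ xs ─ x∈xs
∈-─⁺ (here refl) (here refl)  y≢x = contradiction refl y≢x
∈-─⁺ (here refl) (there y∈xs) y≢x = y∈xs
∈-─⁺ (there x∈xs) (here refl) y≢x = here refl
∈-─⁺ (there x∈xs) (there y∈xs) y≢x = there (∈-─⁺ x∈xs y∈xs y≢x)

module _ {A : Set} (_≟_ : DecidableEquality A) where
  open import Data.List.Membership.DecPropositional _≟_ using (_∈?_)

  unique-pigeonhole : ∀ {xs ys : List A} → Unique xs → length ys < length xs →
                      ∃[ x ] x ∈ xs × x ∉ ys
  unique-pigeonhole {x ∷ xs} {ys} (x≢xs ∷ xs-unique) |ys|<|x∷xs| with x ∈? ys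
  ... | no  x∉ys = x , here refl , x∉ys
  ... | yes x∈ys with unique-pigeonhole {xs} {ys ─ x∈ys} xs-unique |ys─x|<|xs|
    where
      |ys─x|<|xs| : length (ys ─ x∈ys) < length xs
      |ys─x|<|xs| = s≤s⁻¹ (subst (_< suc (length xs)) (length-removeAt′ ys (index x∈ys)) |ys|<|x∷xs|)
  ... | y , y∈xs , y∉ys─x = y , there y∈xs , λ y∈ys → y∉ys─x (∈-─⁺ x∈ys y∈ys y≢x)
    where
      y≢x : y ≢ x
      y≢x y≡x = All.lookup x≢xs y∈xs (sym y≡x)

module _ (D : Digraph) where

  outNeighbours : Vertex D → List (Vertex D)
  outNeighbours u = filter (λ w → T? (arc D u w)) (allFin (n D))

  Unique-outNeighbours : ∀ u → Unique (outNeighbours u)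
  Unique-outNeighbours u = filter⁺ (λ w → T? (arc D u w)) (allFin⁺ (n D))

  ∈-outNeighbours⇒Arc : ∀ {u w} → w ∈ outNeighbours u → Arc D u w
  ∈-outNeighbours⇒Arc {u} w∈N = proj₂ (∈-filter⁻ (λ w → T? (arc D u w)) {xs = allFin (n D)} w∈N)

  outNeighbour-outside : ∀ u (F : List (Vertex D)) → length F < outDeg D u →
                         ∃[ w ] Arc D u w × w ∉ F
  outNeighbour-outside u F |F|<deg with unique-pigeonhole _≟_ (Unique-outNeighbours u) |F|<deg
  ... | w , w∈N , w∉F = w , ∈-outNeighbours⇒Arc w∈N , w∉F

  arc⇒≢ : ∀ {u w} → Arc D u w → w ≢ u
  arc⇒≢ {u} a refl = subst T (loopless D u) a

  minOutDeg≥-mono : ∀ {k m} → k ≤ m → minOutDeg≥ D m → minOutDeg≥ D k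
  minOutDeg≥-mono k≤m δ⁺≥m u = ≤-trans k≤m (δ⁺≥m u)

  trivialPath : Vertex D → Path D 0
  trivialPath u = record { verts = u ∷ [] ; walk = tt ; distinct = [] ∷ [] }

  walk-∷ : ∀ {m} u (vs : Vec (Vertex D) (suc m)) → Arc D u (head vs) → Walk D vs → Walk D (u ∷ vs)
  walk-∷ u (w ∷ ws) u→w walk = u→w , walk

  prepend : ∀ {ℓ} u (P : Path D ℓ) → Arc D u (start P) → ¬ u ∈V P → Path D (suc ℓ)
  prepend u P u→P u∉P = record
    { verts    = u ∷ verts P
    ; walk     = walk-∷ u (verts P) u→P (walk P)
    ; distinct = ¬Any⇒All¬ _ u∉P ∷ distinct P
    }

  Avoids : ∀ {ℓ} → Path D ℓ → List (Vertex D) → Set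
  Avoids P F = All (_∉ F) (toList (verts P))

  avoidingPath : ∀ ℓ (F : List (Vertex D)) → minOutDeg≥ D (length F + ℓ) →
                 ∀ u → u ∉ F → Σ (Path D ℓ) λ P → start P ≡ u × Avoids P F
  avoidingPath zero    F δ⁺≥ u u∉F = trivialPath u , refl , u∉F ∷ []
  avoidingPath (suc ℓ) F δ⁺≥ u u∉F
    with outNeighbour-outside u F (≤-trans (m<m+n (length F) z<s) (δ⁺≥ u))
  ... | w , u→w , w∉F
    with avoidingPath ℓ (u ∷ F) (minOutDeg≥-mono (≤-reflexive (sym (+-suc (length F) ℓ))) δ⁺≥) w w∉u∷F
    where
      w∉u∷F : w ∉ u ∷ F
      w∉u∷F (here w≡u)  = arc⇒≢ u→w w≡u
      w∉u∷F (there w∈F) = w∉F w∈F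
  ... | P , refl , P-avoids =
    prepend u P u→w (λ u∈P → All.lookup P-avoids u∈P (here refl)) , refl ,
    u∉F ∷ All.map (λ x∉u∷F x∈F → x∉u∷F (there x∈F)) P-avoids

  tailVerts : ∀ {ℓ} → Path D ℓ → List (Vertex D)
  tailVerts P = toList (tail (verts P))

  length-tailVerts : ∀ {ℓ} (P : Path D ℓ) → length (tailVerts P) ≡ ℓ
  length-tailVerts P = length-toList (tail (verts P))

  start∉tailVerts : ∀ {ℓ} (P : Path D ℓ) → start P ∉ tailVerts P
  start∉tailVerts record { verts = _ ∷ _ ; distinct = start≢tail ∷ _ } = All¬⇒¬Any start≢tail

  ∈V⇒≡start⊎∈tailVerts : ∀ {ℓ w} (P : Path D ℓ) → w ∈V P → w ≡ start P ⊎ w ∈ tailVerts P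
  ∈V⇒≡start⊎∈tailVerts record { verts = _ ∷ _ } (here w≡start) = inj₁ w≡start
  ∈V⇒≡start⊎∈tailVerts record { verts = _ ∷ _ } (there w∈tail) = inj₂ w∈tail

lemma3p1 : (ℓ₁ ℓ₂ : ℕ) (D : Digraph) → minOutDeg≥ D (ℓ₁ + ℓ₂) →
    (v : Vertex D) →
    Σ (Path D ℓ₁) λ P₁ → Σ (Path D ℓ₂) λ P₂ →
      (start P₁ ≡ v) × (start P₂ ≡ v) ×
      (∀ w → w ∈V P₁ → w ∈V P₂ → w ≡ v)
lemma3p1 ℓ₁ ℓ₂ D δ⁺≥ v
  with avoidingPath D ℓ₁ [] (minOutDeg≥-mono D (m≤m+n ℓ₁ ℓ₂) δ⁺≥) v (λ ())
... | P₁ , refl , _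
  with avoidingPath D ℓ₂ (tailVerts D P₁) δ⁺≥′ (start P₁) (start∉tailVerts D P₁)
  where
    δ⁺≥′ : minOutDeg≥ D (length (tailVerts D P₁) + ℓ₂)
    δ⁺≥′ = minOutDeg≥-mono D (≤-reflexive (cong (_+ ℓ₂) (length-tailVerts D P₁))) δ⁺≥
... | P₂ , P₂-start , P₂-avoids = P₁ , P₂ , refl , P₂-start , meetOnlyAtStart
  where
    meetOnlyAtStart : ∀ w → w ∈V P₁ → w ∈V P₂ → w ≡ start P₁
    meetOnlyAtStart w w∈P₁ w∈P₂ with ∈V⇒≡start⊎∈tailVerts D P₁ w∈P₁
    ... | inj₁ w≡start = w≡start
    ... | inj₂ w∈tail  = contradiction w∈tail (All.lookup P₂-avoids w∈P₂)
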